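{- Let $M$ be a binary matrix such that there do not exist three distinct rows $r_a,r_b,r_c$ whose sets $S_a,S_b,S_c$ are pairwise intersecting and satisfy either (H1) $S_a\cap S_b\cap S_c=\emptyset$ or (H2) none of $S_a,S_b,S_c$ is contained in the union of the other two. Let $c_p,c_q$ be two columns of $M$, and let $C$ be an induced cycle on four vertices in $G(M)[vert(c_p)\cup vert(c_q)]$. Then every set $\mathcal{D}$ of rows of $M$ such that $M\setminus\mathcal{D}$ has the Consecutive Ones Property contains at least one of the four rows corresponding to the vertices of $C$.
   Context: A binary matrix has the Consecutive Ones Property (COP) if there is a permutation of its columns after which, in every row, the $1$-entries are consecutive; $M\setminus\mathcal{D}$ is the submatrix on rows not in $\mathcal{D}$. For a binary matrix $M$ with rows $r_1,\dots,r_m$ and columns $c_1,\dots,c_n$: $S_i=\{j : M_{ij}=1\}$; the derived graph $G(M)$ has vertex set $\{v_1,\dots,v_m\}$ ($v_i$ corresponds to row $r_i$) and an edge $\{v_i,v_j\}$ ($i\ne j$) whenever some column $c_k$ has $M_{ik}=M_{jk}=1$; $vert(c_k)=\{v_i : M_{ik}=1\}$. $G[X]$ denotes the induced subgraph on $X$. Sets are pairwise intersecting if every two have nonempty intersection. -}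

module Defs where

open import Data.Nat using (ℕ)
open import Data.Fin using (Fin; _<_)
open import Data.Bool using (Bool; true; false)
open import Data.Product using (Σ; _×_; ∃; ∃-syntax)
open import Data.Sum using (_⊎_)
open import Relation.Nullary using (¬_)
open import Relation.Binary.PropositionalEquality using (_≡_; _≢_)
open import Function.Bundles using (_↔_; Inverse)

Matrix : ℕ → ℕ → Set
Matrix m n = Fin m → Fin n → Bool

module _ {m n : ℕ} (M : Matrix m n) where

  InS : Fin m → Fin n → Set
  InS i k = M i k ≡ true

  Meet : Fin m → Fin m → Set
  Meet a b = ∃[ k ] (InS a k × InS b k)

  PairwiseIntersecting : Fin m → Fin m → Fin m → Set
  PairwiseIntersecting a b c = Meet a b × Meet a c × Meet b c

  H1 : Fin m → Fin m → Fin m → Set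
  H1 a b c = ¬ (∃[ k ] (InS a k × InS b k × InS c k))

  NotCovered : Fin m → Fin m → Fin m → Set
  NotCovered a b c = ∃[ k ] (InS a k × ¬ InS b k × ¬ InS c k)

  H2 : Fin m → Fin m → Fin m → Set
  H2 a b c = NotCovered a b c × NotCovered b a c × NotCovered c a b

  BadTriple : Fin m → Fin m → Fin m → Set
  BadTriple a b c =
    a ≢ b × a ≢ c × b ≢ c × PairwiseIntersecting a b c × (H1 a b c ⊎ H2 a b c)

  Adj : Fin m → Fin m → Set
  Adj i j = i ≢ j × Meet i j

  InVert : Fin n → Fin m → Set
  InVert k i = InS i k

  InVertUnion : Fin n → Fin n → Fin m → Set
  InVertUnion p q i = InVert p i ⊎ InVert q i

  InducedC4 : Fin n → Fin n → Fin m → Fin m → Fin m → Fin m → Set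
  InducedC4 p q v0 v1 v2 v3 =
    (InVertUnion p q v0 × InVertUnion p q v1 × InVertUnion p q v2 × InVertUnion p q v3)
    × (v0 ≢ v1 × v0 ≢ v2 × v0 ≢ v3 × v1 ≢ v2 × v1 ≢ v3 × v2 ≢ v3)
    × (Adj v0 v1 × Adj v1 v2 × Adj v2 v3 × Adj v3 v0)
    × (¬ Adj v0 v2 × ¬ Adj v1 v3)

  -- Row i has consecutive ones under the column order σ (position x holds
  -- column Inverse.to σ x): whenever positions x < y < z and the entries at x
  -- and z are 1, the entry at y is 1.
  ConsecutiveRow : (Fin n ↔ Fin n) → Fin m → Set
  ConsecutiveRow σ i = ∀ (x y z : Fin n) → x < y → y < z →
    InS i (Inverse.to σ x) → InS i (Inverse.to σ z) → InS i (Inverse.to σ y)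

  COPWithout : (Fin m → Bool) → Set
  COPWithout D = ∃[ σ ] (∀ (i : Fin m) → D i ≡ false → ConsecutiveRow σ i)

module Submission where

-- After ordering the columns
-- so that every remaining row is consecutive, each row becomes an interval of
-- positions; adjacent rows give overlapping intervals and the two
-- non-adjacent pairs give disjoint ones.  But intervals cannot form an
-- induced four-cycle (interval graphs are chordal), so one of the four rows
-- must have been deleted.

open import Defs
open import Level using (Level)
open import Data.Nat using (ℕ)
open import Data.Fin using (Fin; _<_)
open import Data.Fin.Properties using (<-cmp)
open import Data.Bool using (Bool; true; false)
open import Data.Empty using (⊥; ⊥-elim)
open import Data.Product using (_,_; proj₁)
open import Data.Sum using (_⊎_; inj₁; inj₂)
open import Relation.Nullary using (¬_)
open import Relation.Unary using (Pred; _≬_) renaming (_⊥_ to Disjoint)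
open import Relation.Binary.Definitions using (tri<; tri≈; tri>)
open import Relation.Binary.PropositionalEquality using (_≡_; _≢_; refl; sym; subst)
open import Function.Bundles using (_↔_; Inverse)

module _ {n : ℕ} {ℓ : Level} where

  Convex : Pred (Fin n) ℓ → Set ℓ
  Convex P = ∀ (x y z : Fin n) → x < y → y < z → P x → P z → P y

  -- If a convex C is disjoint from A and a point x of A lies left of a point
  -- z of C, then all of C lies right of x: otherwise x would sit inside C.
  convex-beyond : {A C : Pred (Fin n) ℓ} → Convex C → Disjoint A C →
    ∀ {x z} → A x → C z → x < z → ∀ {y} → C y → x < y
  convex-beyond convC A⊥C {x} {z} ax cz x<z {y} cy with <-cmp x y
  ... | tri< x<y _ _ = x<y
  ... | tri≈ _ refl _ = ⊥-elim (A⊥C (ax , cy))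
  ... | tri> _ _ y<x = ⊥-elim (A⊥C (ax , convC y x z y<x x<z cy cz))

  -- Both the point p2 ∈ B ∩ C and p4 ∈ E ∩ A lie right of p1, and
  -- whichever of them is further left is swallowed by the interval (A or B)
  -- stretching from p1 to the other one.
  no-ordered-interval-C4 : {A B C E : Pred (Fin n) ℓ} →
    Convex A → Convex B → Convex C → Convex E →
    Disjoint A C → Disjoint B E →
    (AB : A ≬ B) → B ≬ C → (CE : C ≬ E) → E ≬ A →
    proj₁ AB < proj₁ CE → ⊥
  no-ordered-interval-C4 convA convB convC convE A⊥C B⊥E
    (p1 , a1 , b1) (p2 , b2 , c2) (p3 , c3 , e3) (p4 , e4 , a4) p1<p3
    with <-cmp p2 p4
  ... | tri< p2<p4 _ _ = A⊥C (convA p1 p2 p4 p1<p2 p2<p4 a1 a4 , c2)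
    where
    p1<p2 : p1 < p2
    p1<p2 = convex-beyond convC A⊥C a1 c3 p1<p3 c2
  ... | tri≈ _ refl _ = A⊥C (a4 , c2)
  ... | tri> _ _ p4<p2 = B⊥E (convB p1 p4 p2 p1<p4 p4<p2 b1 b2 , e4)
    where
    p1<p4 : p1 < p4
    p1<p4 = convex-beyond convE B⊥E b1 e3 p1<p3 e4

  -- Intervals cannot form an induced four-cycle: the symmetric case
  -- reduces to the ordered one by rotating the cycle by two.
  no-interval-C4 : {A B C E : Pred (Fin n) ℓ} →
    Convex A → Convex B → Convex C → Convex E →
    Disjoint A C → Disjoint B E →
    A ≬ B → B ≬ C → C ≬ E → E ≬ A → ⊥
  no-interval-C4 convA convB convC convE A⊥C B⊥E
    AB@(p1 , a1 , _) BC CE@(p3 , c3 , _) EA with <-cmp p1 p3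
  ... | tri< p1<p3 _ _ =
    no-ordered-interval-C4 convA convB convC convE A⊥C B⊥E AB BC CE EA p1<p3
  ... | tri≈ _ refl _ = A⊥C (a1 , c3)
  ... | tri> _ _ p3<p1 =
    no-ordered-interval-C4 convC convE convA convB
      (λ (c , a) → A⊥C (a , c)) (λ (e , b) → B⊥E (b , e)) CE EA AB BC p3<p1

module _ {m n : ℕ} (M : Matrix m n) (σ : Fin n ↔ Fin n) where

  -- Row i seen through the column order σ: the positions holding a 1.
  -- A consecutive row is, by definition, a convex set of positions.
  RowAt : Fin m → Pred (Fin n) _
  RowAt i x = InS M i (Inverse.to σ x)

  meet-overlap : ∀ {i j} → Meet M i j → RowAt i ≬ RowAt j
  meet-overlap {i} {j} (k , ik , jk) =
    Inverse.from σ k , at-k i ik , at-k j jk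
    where
    at-k : ∀ r → InS M r k → RowAt r (Inverse.from σ k)
    at-k r rk = subst (λ c → InS M r c) (sym (Inverse.strictlyInverseˡ σ k)) rk

  non-adjacent-disjoint : ∀ {i j} → i ≢ j → ¬ Adj M i j →
    Disjoint (RowAt i) (RowAt j)
  non-adjacent-disjoint i≢j ¬adj {x} (ix , jx) = ¬adj (i≢j , Inverse.to σ x , ix , jx)

  no-consecutive-C4 : ∀ {p q v0 v1 v2 v3} → InducedC4 M p q v0 v1 v2 v3 →
    ConsecutiveRow M σ v0 → ConsecutiveRow M σ v1 →
    ConsecutiveRow M σ v2 → ConsecutiveRow M σ v3 → ⊥
  no-consecutive-C4
    (_ , (_ , v0≢v2 , _ , _ , v1≢v3 , _)
       , ((_ , m01) , (_ , m12) , (_ , m23) , (_ , m30)) , (¬a02 , ¬a13))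
    c0 c1 c2 c3 =
    no-interval-C4 c0 c1 c2 c3
      (non-adjacent-disjoint v0≢v2 ¬a02) (non-adjacent-disjoint v1≢v3 ¬a13)
      (meet-overlap m01) (meet-overlap m12) (meet-overlap m23) (meet-overlap m30)

lemma6 : {m n : ℕ} (M : Matrix m n) →
    (∀ (a b c : Fin m) → ¬ BadTriple M a b c) →
    (p q : Fin n) (v0 v1 v2 v3 : Fin m) → InducedC4 M p q v0 v1 v2 v3 →
    (D : Fin m → Bool) → COPWithout M D →
    (D v0 ≡ true ⊎ D v1 ≡ true ⊎ D v2 ≡ true ⊎ D v3 ≡ true)
lemma6 M _ p q v0 v1 v2 v3 c4 D (σ , cop)
  with D v0 in e0 | D v1 in e1 | D v2 in e2 | D v3 in e3
... | true  | _     | _     | _     = inj₁ refl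
... | false | true  | _     | _     = inj₂ (inj₁ refl)
... | false | false | true  | _     = inj₂ (inj₂ (inj₁ refl))
... | false | false | false | true  = inj₂ (inj₂ (inj₂ refl))
... | false | false | false | false =
  ⊥-elim (no-consecutive-C4 M σ c4 (cop v0 e0) (cop v1 e1) (cop v2 e2) (cop v3 e3))
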